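{- Let $s\ge 3$ be an integer. Every $s$-regular abelian group $\mathbb{Z}_c\times\mathbb{Z}_{ck}$ (with integers $c\ge 2$, $k\ge 1$) has order at most $2s^2+2s-4$, and equality holds if and only if the group is isomorphic to $\mathbb{Z}_3\times\mathbb{Z}_{(2s^2+2s-4)/3}$ with $s\equiv 1\pmod 3$.
   Context: $\mathbb{Z}_n=\mathbb{Z}/n\mathbb{Z}$. For integers $c\ge 2$, $k\ge1$, the group $\mathbb{Z}_c\times\mathbb{Z}_{ck}$ is called $s$-regular if there exist $u,v\in\mathbb{Z}_{ck}$ such that every element of the group equals $\lambda_1(1,u)+\lambda_2(1,v)$ for some integers $\lambda_1,\lambda_2$ with $|\lambda_1|+|\lambda_2|\le s$. -}

module Defs where

open import Data.Nat using (ℕ)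
open import Data.Integer using (ℤ; +_; _+_; _-_; _*_; ∣_∣)
open import Data.Integer.Divisibility using (_∣_)
open import Data.Product using (_×_; _,_; Σ; ∃; proj₁; proj₂)
import Data.Nat as N

_≡[_]_ : ℤ → ℕ → ℤ → Set
a ≡[ n ] b = (+ n) ∣ (a - b)

-- The group Z_c × Z_{ck} is s-regular: there are u, v ∈ Z_{ck} (represented by
-- integers) such that every element (x , y) (represented by integers) equals
-- λ₁(1,u) + λ₂(1,v) with |λ₁| + |λ₂| ≤ s.
SRegular : ℕ → ℕ → ℕ → Set
SRegular s c k =
  Σ ℤ λ u → Σ ℤ λ v → (x y : ℤ) →
    Σ ℤ λ l₁ → Σ ℤ λ l₂ →
      (∣ l₁ ∣ N.+ ∣ l₂ ∣ N.≤ s) ×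
      ((l₁ + l₂) ≡[ c ] x) ×
      ((l₁ * u + l₂ * v) ≡[ c N.* k ] y)

_≈[_,_]_ : ℤ × ℤ → ℕ → ℕ → ℤ × ℤ → Set
p ≈[ a , b ] q = (proj₁ p ≡[ a ] proj₁ q) × (proj₂ p ≡[ b ] proj₂ q)

_⊕_ : ℤ × ℤ → ℤ × ℤ → ℤ × ℤ
(x , y) ⊕ (x' , y') = (x + x' , y + y')

Isomorphic : ℕ → ℕ → ℕ → ℕ → Set
Isomorphic a b a' b' =
  Σ (ℤ × ℤ → ℤ × ℤ) λ f →
    (∀ p q → p ≈[ a , b ] q → f p ≈[ a' , b' ] f q) ×
    (∀ p q → f (p ⊕ q) ≈[ a' , b' ] (f p ⊕ f q)) ×
    (∀ p q → f p ≈[ a' , b' ] f q → p ≈[ a , b ] q) ×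
    (∀ r → Σ (ℤ × ℤ) λ p → f p ≈[ a' , b' ] r)

module Submission where

-- Write l₁ (1 , u) + l₂ (1 , v) with |l₁| + |l₂| ≤ s in the coordinates P = l₁ + l₂ + s,
-- Q = l₁ - l₂ + s: these lie in [0 , 2s], have P ≡ Q (mod 2) and determine (l₁ , l₂). The first
-- coordinate of a target fixes P modulo c, so the c k elements of one coset {x} × ℤ_{ck} inject
-- into the points (P , Q) with P in one residue class, which gives c²k ≤ ((2s + 1)² - d) / 2 for an
-- explicit defect d. Choosing the class according to the parities of c and of ⌊(2s + 1) / c⌋
-- makes d ≥ 11, i.e. c²k < 2s² + 2s - 4, unless c is odd and divides 2s + 1. Then u - v is a unit
-- modulo c, so on the k targets of a coset of the subgroup {0} × cℤ_{ck} the coefficients are fixed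
-- modulo c; choosing it with P ≡ 0 and Q ≡ 1 (mod c) gives c²k ≤ ((2s + 1)² - c²) / 2, which is
-- 2s² + 2s - 4 exactly for c = 3, where 3 ∣ 2s + 1 means s ≡ 1 (mod 3).

open import Defs
open import Data.Nat.Base using (ℕ)

module Arithmetic where

  open import Data.Nat
  open import Data.Nat.Properties
  open import Data.Nat.DivMod
  open import Data.Nat.Tactic.RingSolver using (solve-∀)
  open import Data.Product using (Σ; _×_; _,_)
  open import Data.Sum using (_⊎_; inj₁; inj₂)
  open import Data.Fin using (Fin; toℕ; fromℕ<)
  import Data.Fin.Properties as Fin
  open import Relation.Binary.PropositionalEquality
  open ≡-Reasoning

  %-congˡ-+ : ∀ {a b} n d .{{_ : NonZero d}} → a % d ≡ b % d → (a + n) % d ≡ (b + n) % d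
  %-congˡ-+ {a} {b} n d a≡b = begin
    (a + n) % d             ≡⟨ %-distribˡ-+ a n d ⟩
    (a % d + n % d) % d     ≡⟨ cong (λ r → (r + n % d) % d) a≡b ⟩
    (b % d + n % d) % d     ≡⟨ %-distribˡ-+ b n d ⟨
    (b + n) % d             ∎

  even-sum⇒%2≡ : ∀ m n w → m + n ≡ w * 2 → m % 2 ≡ n % 2
  even-sum⇒%2≡ m n w m+n≡2w = residues (m % 2) (n % 2) (m%n<n m 2) (m%n<n n 2) (begin
    (m % 2 + n % 2) % 2     ≡⟨ %-distribˡ-+ m n 2 ⟨
    (m + n) % 2             ≡⟨ cong (_% 2) m+n≡2w ⟩
    w * 2 % 2               ≡⟨ m*n%n≡0 w 2 ⟩
    0                       ∎)
    where
    residues : ∀ a b → a < 2 → b < 2 → (a + b) % 2 ≡ 0 → a ≡ b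
    residues 0 0 _ _ _ = refl
    residues 1 1 _ _ _ = refl
    residues 0 1 _ _ ()
    residues 1 0 _ _ ()
    residues (suc (suc _)) _ (s≤s (s≤s ())) _ _
    residues _ (suc (suc _)) _ (s≤s (s≤s ())) _

  +*≡+*⇒%≡ : ∀ {a b x y d} .{{_ : NonZero d}} → a + x * d ≡ b + y * d → a % d ≡ b % d
  +*≡+*⇒%≡ {a} {b} {x} {y} {d} eq = begin
    a % d           ≡⟨ [m+kn]%n≡m%n a x d ⟨
    (a + x * d) % d ≡⟨ cong (_% d) eq ⟩
    (b + y * d) % d ≡⟨ [m+kn]%n≡m%n b y d ⟩
    b % d           ∎

  ≡+*⇒%≡ : ∀ {a b y d} .{{_ : NonZero d}} → a ≡ b + y * d → a % d ≡ b % d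
  ≡+*⇒%≡ {b = b} {y} {d} eq = trans (cong (_% d) eq) ([m+kn]%n≡m%n b y d)

  +*2≡2s+1⇒%2≡1 : ∀ {ρ x s} → ρ + x * 2 ≡ suc (s + s) → ρ % 2 ≡ 1
  +*2≡2s+1⇒%2≡1 {ρ} {x} {s} eq = +*≡+*⇒%≡ {ρ} {1} {x} {s} (trans eq (odd s))
    where
    odd : ∀ s → suc (s + s) ≡ 1 + s * 2
    odd = solve-∀

  parity-split : ∀ n → (Σ ℕ λ h → n ≡ h * 2) ⊎ (Σ ℕ λ h → n ≡ suc (h * 2))
  parity-split zero = inj₁ (0 , refl)
  parity-split (suc n) with parity-split n
  ... | inj₁ (h , refl) = inj₂ (h , refl)
  ... | inj₂ (h , refl) = inj₁ (suc h , refl)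

  +-*-injective : ∀ {d q q' r r'} → r < d → r' < d → r + q * d ≡ r' + q' * d → r ≡ r' × q ≡ q'
  +-*-injective {d} {q} {q'} {r} {r'} r<d r'<d eq = r≡r' , *-cancelʳ-≡ q q' d (+-cancelˡ-≡ r _ _ eq')
    where
    instance
      d≢0 : NonZero d
      d≢0 = >-nonZero (<-≤-trans (s≤s z≤n) r<d)
    r≡r' : r ≡ r'
    r≡r' = begin
      r                 ≡⟨ m<n⇒m%n≡m r<d ⟨
      r % d             ≡⟨ [m+kn]%n≡m%n r q d ⟨
      (r + q * d) % d   ≡⟨ cong (_% d) eq ⟩
      (r' + q' * d) % d ≡⟨ [m+kn]%n≡m%n r' q' d ⟩
      r' % d            ≡⟨ m<n⇒m%n≡m r'<d ⟩
      r'                ∎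
    eq' : r + q * d ≡ r + q' * d
    eq' = trans eq (cong (_+ q' * d) (sym r≡r'))

  injectiveOn⇒≤ : ∀ {m n} (f : ℕ → ℕ) → (∀ {i} → i < m → f i < n) →
    (∀ {i j} → i < m → j < m → f i ≡ f j → i ≡ j) → m ≤ n
  injectiveOn⇒≤ f f< f-injective = Fin.injective⇒≤ g-injective
    where
    g : Fin _ → Fin _
    g i = fromℕ< (f< (Fin.toℕ<n i))
    g-injective : ∀ {i j} → g i ≡ g j → i ≡ j
    g-injective {i} {j} g≡ = Fin.toℕ-injective (f-injective (Fin.toℕ<n i) (Fin.toℕ<n j)
      (trans (sym (Fin.toℕ-fromℕ< _)) (trans (cong toℕ g≡) (Fin.toℕ-fromℕ< _))))

  residue-class-injection⇒≤ : ∀ {n r T} (z : ℕ → ℕ) → (∀ j → z j % 2 ≡ r) → (∀ j → z j < r + T * 2) →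
    (∀ {j j'} → j < n → j' < n → z j ≡ z j' → j ≡ j') → n ≤ T
  residue-class-injection⇒≤ {r = r} {T} z z%2 z< z-injective = injectiveOn⇒≤ half half< half-injective
    where
    half : ℕ → ℕ
    half j = z j / 2
    z≡ : ∀ j → z j ≡ r + half j * 2
    z≡ j = trans (m≡m%n+[m/n]*n (z j) 2) (cong (_+ half j * 2) (z%2 j))
    half< : ∀ {j} → j < _ → half j < T
    half< {j} _ = *-cancelʳ-< 2 (half j) T (+-cancelˡ-< r _ _ (subst (_< r + T * 2) (z≡ j) (z< j)))
    half-injective : ∀ {j j'} → j < _ → j' < _ → half j ≡ half j' → j ≡ j'
    half-injective {j} {j'} j< j'< half≡ =
      z-injective j< j'< (trans (z≡ j) (trans (cong (λ h → r + h * 2) half≡) (sym (z≡ j'))))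

module Congruences where

  open import Data.Nat as N using (ℕ; NonZero)
  import Data.Nat.Properties as NP
  import Data.Nat.DivMod as NDM
  import Data.Nat.Divisibility as ND
  open import Data.Integer using (ℤ; +_; ∣_∣; _+_; _-_; _*_)
  import Data.Integer.Properties as ZP
  import Data.Integer.DivMod as ZD
  import Data.Integer.Divisibility.Signed as S
  open import Data.Integer.Tactic.RingSolver using (solve-∀)
  open import Data.Product using (Σ; _×_; _,_)
  open import Data.Sum using (inj₁; inj₂)
  open import Relation.Binary.PropositionalEquality
  open ≡-Reasoning

  ≡[]⇒∣ : ∀ {n} a b → a ≡[ n ] b → + n S.∣ a - b
  ≡[]⇒∣ {n} a b = S.∣ᵤ⇒∣ {+ n} {a - b}

  ∣⇒≡[] : ∀ {n} a b → + n S.∣ a - b → a ≡[ n ] b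
  ∣⇒≡[] {n} a b = S.∣⇒∣ᵤ {+ n} {a - b}

  ≡[]-refl : ∀ {n} a → a ≡[ n ] a
  ≡[]-refl a = ∣⇒≡[] a a (S.divides (+ 0) (ZP.+-inverseʳ a))

  ≡[]-sym : ∀ {n a b} → a ≡[ n ] b → b ≡[ n ] a
  ≡[]-sym {n} {a} {b} = subst (n ND.∣_) (ZP.∣i-j∣≡∣j-i∣ a b)

  ≡[]-trans : ∀ {n a b c} → a ≡[ n ] b → b ≡[ n ] c → a ≡[ n ] c
  ≡[]-trans {n} {a} {b} {c} a≡b b≡c =
    ∣⇒≡[] a c (subst (+ n S.∣_) (telescope a b c) (S.∣m∣n⇒∣m+n (≡[]⇒∣ a b a≡b) (≡[]⇒∣ b c b≡c)))
    where
    telescope : ∀ a b c → (a - b) + (b - c) ≡ a - c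
    telescope = solve-∀

  ≈-refl : ∀ {a b} p → p ≈[ a , b ] p
  ≈-refl (x , y) = ≡[]-refl x , ≡[]-refl y

  ≈-sym : ∀ {a b} p q → p ≈[ a , b ] q → q ≈[ a , b ] p
  ≈-sym (x₁ , y₁) (x₂ , y₂) (x₁≡x₂ , y₁≡y₂) =
    ≡[]-sym {a = x₁} {x₂} x₁≡x₂ , ≡[]-sym {a = y₁} {y₂} y₁≡y₂

  ≈-trans : ∀ {a b} p q r → p ≈[ a , b ] q → q ≈[ a , b ] r → p ≈[ a , b ] r
  ≈-trans (x₁ , y₁) (x₂ , y₂) _ (x₁≡x₂ , y₁≡y₂) (x₂≡x₃ , y₂≡y₃) =
    ≡[]-trans {a = x₁} {x₂} x₁≡x₂ x₂≡x₃ , ≡[]-trans {a = y₁} {y₂} y₁≡y₂ y₂≡y₃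

  ≡[*]⇒≡[] : ∀ {n a b} m → a ≡[ n N.* m ] b → a ≡[ n ] b
  ≡[*]⇒≡[] m = ND.∣-trans (ND.m∣m*n m)

  ≥-≡[]⇒%≡ : ∀ {n a b} .{{_ : NonZero n}} → b N.≤ a → (+ a) ≡[ n ] (+ b) → a N.% n ≡ b N.% n
  ≥-≡[]⇒%≡ {n} {a} {b} b≤a (ND.divides q eq) = begin
    a N.% n                 ≡⟨ cong (N._% n) (NP.m+[n∸m]≡n b≤a) ⟨
    (b N.+ (a N.∸ b)) N.% n ≡⟨ cong (λ t → (b N.+ t) N.% n) (trans distance eq) ⟩
    (b N.+ q N.* n) N.% n   ≡⟨ NDM.[m+kn]%n≡m%n b q n ⟩
    b N.% n                 ∎
    where
    distance : a N.∸ b ≡ ∣ + a - + b ∣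
    distance = sym (cong ∣_∣ (trans (ZP.m-n≡m⊖n a b) (ZP.⊖-≥ b≤a)))

  ≡[]⇒%≡ : ∀ {n a b} .{{_ : NonZero n}} → (+ a) ≡[ n ] (+ b) → a N.% n ≡ b N.% n
  ≡[]⇒%≡ {a = a} {b} a≡b with NP.≤-total b a
  ... | inj₁ b≤a = ≥-≡[]⇒%≡ b≤a a≡b
  ... | inj₂ a≤b = sym (≥-≡[]⇒%≡ a≤b (≡[]-sym {a = + a} {+ b} a≡b))

  ≡[]-<⇒≡ : ∀ {n a b} → a N.< n → b N.< n → (+ a) ≡[ n ] (+ b) → a ≡ b
  ≡[]-<⇒≡ {n} {a} {b} a<n b<n a≡b = begin
    a       ≡⟨ NDM.m<n⇒m%n≡m a<n ⟨
    a N.% n ≡⟨ ≡[]⇒%≡ a≡b ⟩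
    b N.% n ≡⟨ NDM.m<n⇒m%n≡m b<n ⟩
    b       ∎
    where
    instance
      n≢0 : NonZero n
      n≢0 = N.>-nonZero (NP.<-≤-trans (N.s≤s N.z≤n) a<n)

  canonical : ∀ n .{{_ : NonZero n}} z → Σ ℕ λ r → r N.< n × z ≡[ n ] (+ r)
  canonical n z = z ZD.%ℕ n , ZD.n%ℕd<d z n , ∣⇒≡[] z (+ (z ZD.%ℕ n)) (S.divides (z ZD./ℕ n) remainder)
    where
    remainder : z - + (z ZD.%ℕ n) ≡ z ZD./ℕ n * + n
    remainder = begin
      z - + (z ZD.%ℕ n)                                      ≡⟨ cong (_- + (z ZD.%ℕ n)) (ZD.a≡a%ℕn+[a/ℕn]*n z n) ⟩
      + (z ZD.%ℕ n) + z ZD./ℕ n * + n - + (z ZD.%ℕ n)         ≡⟨ cancel (+ (z ZD.%ℕ n)) (z ZD./ℕ n * + n) ⟩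
      z ZD./ℕ n * + n                                        ∎
      where
      cancel : ∀ r x → r + x - r ≡ x
      cancel = solve-∀

module Quotients where

  open import Data.Nat
  open import Data.Nat.Properties
  open import Data.Nat.DivMod
  open import Data.Integer using (ℤ; +_)
  open import Data.Product using (_×_; _,_; proj₁; proj₂)
  open import Function.Base using (id)
  open import Relation.Binary.PropositionalEquality
  open Arithmetic
  open Congruences

  -- Counting through canonical representatives: t < b' a' names the element (t % a' , t / a'),
  -- and a preimage (x , y) reduces to the index x % a + (y % b) a < b a.
  Isomorphic⇒order≤ : ∀ {a b a' b'} .{{_ : NonZero a}} .{{_ : NonZero b}} .{{_ : NonZero a'}} →
    Isomorphic a b a' b' → b' * a' ≤ b * a
  Isomorphic⇒order≤ {a} {b} {a'} {b'} (f , f-cong , _ , _ , f-surjective) = injectiveOn⇒≤ index index< index-injective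
    where
    element : ℕ → ℤ × ℤ
    element t = + (t % a') , + (t / a')
    preimage : ℕ → ℤ × ℤ
    preimage t = proj₁ (f-surjective (element t))
    x y : ℕ → ℕ
    x t = proj₁ (canonical a (proj₁ (preimage t)))
    y t = proj₁ (canonical b (proj₂ (preimage t)))
    x<a : ∀ t → x t < a
    x<a t = proj₁ (proj₂ (canonical a (proj₁ (preimage t))))
    y<b : ∀ t → y t < b
    y<b t = proj₁ (proj₂ (canonical b (proj₂ (preimage t))))
    preimage≈ : ∀ t → preimage t ≈[ a , b ] (+ x t , + y t)
    preimage≈ t = proj₂ (proj₂ (canonical a (proj₁ (preimage t)))) , proj₂ (proj₂ (canonical b (proj₂ (preimage t))))
    index : ℕ → ℕ
    index t = x t + y t * a
    index< : ∀ {t} → t < b' * a' → index t < b * a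
    index< {t} _ = <-≤-trans (+-monoˡ-< (y t * a) (x<a t)) (*-monoˡ-≤ a (y<b t))
    index-injective : ∀ {t t'} → t < b' * a' → t' < b' * a' → index t ≡ index t' → t ≡ t'
    index-injective {t} {t'} t< t'< index≡ = begin
      t                      ≡⟨ m≡m%n+[m/n]*n t a' ⟩
      t % a' + t / a' * a'   ≡⟨ cong₂ (λ r q → r + q * a') (≡[]-<⇒≡ (m%n<n t a') (m%n<n t' a') (proj₁ same))
                                                           (≡[]-<⇒≡ (m<n*o⇒m/o<n t<) (m<n*o⇒m/o<n t'<) (proj₂ same)) ⟩
      t' % a' + t' / a' * a' ≡⟨ m≡m%n+[m/n]*n t' a' ⟨
      t'                     ∎
      where
      open ≡-Reasoning
      x≡∧y≡ : x t ≡ x t' × y t ≡ y t'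
      x≡∧y≡ = +-*-injective {a} {y t} {y t'} {x t} {x t'} (x<a t) (x<a t') index≡
      preimages≈ : preimage t ≈[ a , b ] preimage t'
      preimages≈ = ≈-trans (preimage t) _ (preimage t') (preimage≈ t)
        (subst₂ (λ x y → (+ x , + y) ≈[ a , b ] preimage t') (sym (proj₁ x≡∧y≡)) (sym (proj₂ x≡∧y≡))
          (≈-sym (preimage t') _ (preimage≈ t')))
      same : element t ≈[ a' , b' ] element t'
      same = ≈-trans (element t) (f (preimage t)) (element t') (≈-sym (f (preimage t)) _ (proj₂ (f-surjective (element t))))
        (≈-trans (f (preimage t)) (f (preimage t')) (element t') (f-cong _ _ preimages≈) (proj₂ (f-surjective (element t'))))

  Isomorphic-refl : ∀ a b → Isomorphic a b a b
  Isomorphic-refl a b =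
    id , (λ _ _ p≈q → p≈q) , (λ p q → ≈-refl (p ⊕ q)) , (λ _ _ p≈q → p≈q) , (λ r → r , ≈-refl r)

module DiagonalCoordinates where

  open import Data.Nat as N using (ℕ)
  import Data.Nat.Properties as NP
  open import Data.Integer using (ℤ; +_; -[1+_]; ∣_∣; _+_; _-_; _*_)
  import Data.Integer.Properties as ZP
  open import Data.Integer.Tactic.RingSolver using (solve-∀)
  open import Data.Product using (Σ; _×_; _,_)
  open import Relation.Binary.PropositionalEquality
  open ≡-Reasoning
  open Arithmetic using (even-sum⇒%2≡)

  shift : ∀ s z → ∣ z ∣ N.≤ s → Σ ℕ λ n → n N.≤ s N.+ s × + n ≡ z + + s
  shift s (+ n)    n≤s = n N.+ s , NP.+-monoˡ-≤ s n≤s , refl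
  shift s -[1+ n ] n<s = s N.∸ N.suc n , NP.≤-trans (NP.m∸n≤m s (N.suc n)) (NP.m≤m+n s s) , sym (ZP.⊖-≥ n<s)

  record Diagonal (s : ℕ) (l₁ l₂ : ℤ) : Set where
    field
      P Q     : ℕ
      P≤2s    : P N.≤ s N.+ s
      Q≤2s    : Q N.≤ s N.+ s
      +P≡     : + P ≡ l₁ + l₂ + + s
      +Q≡     : + Q ≡ l₁ - l₂ + + s
      P≡Q[2]  : P N.% 2 ≡ Q N.% 2

  diagonal : ∀ {s l₁ l₂} → ∣ l₁ ∣ N.+ ∣ l₂ ∣ N.≤ s → Diagonal s l₁ l₂
  diagonal {s} {l₁} {l₂} short with shift s (l₁ + l₂) (NP.≤-trans (ZP.∣i+j∣≤∣i∣+∣j∣ l₁ l₂) short)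
                                 | shift s (l₁ - l₂) (NP.≤-trans (ZP.∣i-j∣≤∣i∣+∣j∣ l₁ l₂) short)
                                 | shift s l₁ (NP.≤-trans (NP.m≤m+n ∣ l₁ ∣ ∣ l₂ ∣) short)
  ... | P , P≤2s , +P≡ | Q , Q≤2s , +Q≡ | W , _ , +W≡ = record
    { P = P ; Q = Q ; P≤2s = P≤2s ; Q≤2s = Q≤2s ; +P≡ = +P≡ ; +Q≡ = +Q≡
    ; P≡Q[2] = even-sum⇒%2≡ P Q W (ZP.+-injective (begin
        + P + + Q                               ≡⟨ cong₂ _+_ +P≡ +Q≡ ⟩
        (l₁ + l₂ + + s) + (l₁ - l₂ + + s)       ≡⟨ sum l₁ l₂ (+ s) ⟩
        (l₁ + + s) * + 2                        ≡⟨ cong (_* + 2) +W≡ ⟨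
        + W * + 2                               ≡⟨ ZP.pos-* W 2 ⟨
        + (W N.* 2)                             ∎)) }
    where
    sum : ∀ a b c → (a + b + c) + (a - b + c) ≡ (a + c) * + 2
    sum = solve-∀

  diagonal-injective : ∀ {s l₁ l₂ l₁' l₂'} (d : Diagonal s l₁ l₂) (d' : Diagonal s l₁' l₂') →
    Diagonal.P d ≡ Diagonal.P d' → Diagonal.Q d ≡ Diagonal.Q d' → l₁ ≡ l₁' × l₂ ≡ l₂'
  diagonal-injective {s} {l₁} {l₂} {l₁'} {l₂'} d d' P≡P' Q≡Q' = l₁≡l₁' , l₂≡l₂'
    where
    open Diagonal
    sum≡ : l₁ + l₂ + + s ≡ l₁' + l₂' + + s
    sum≡ = trans (sym (+P≡ d)) (trans (cong +_ P≡P') (+P≡ d'))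
    difference≡ : l₁ - l₂ + + s ≡ l₁' - l₂' + + s
    difference≡ = trans (sym (+Q≡ d)) (trans (cong +_ Q≡Q') (+Q≡ d'))
    twice : ∀ a b c → (a + b + c) + (a - b + c) - (c + c) ≡ + 2 * a
    twice = solve-∀
    second : ∀ a b c → (a + b + c) - a - c ≡ b
    second = solve-∀
    l₁≡l₁' : l₁ ≡ l₁'
    l₁≡l₁' = ZP.*-cancelˡ-≡ (+ 2) l₁ l₁' (begin
      + 2 * l₁                                              ≡⟨ twice l₁ l₂ (+ s) ⟨
      (l₁ + l₂ + + s) + (l₁ - l₂ + + s) - (+ s + + s)       ≡⟨ cong₂ (λ a b → a + b - (+ s + + s))
                                                                    sum≡ difference≡ ⟩
      (l₁' + l₂' + + s) + (l₁' - l₂' + + s) - (+ s + + s)   ≡⟨ twice l₁' l₂' (+ s) ⟩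
      + 2 * l₁'                                             ∎)
    l₂≡l₂' : l₂ ≡ l₂'
    l₂≡l₂' = begin
      l₂                       ≡⟨ second l₁ l₂ (+ s) ⟨
      (l₁ + l₂ + + s) - l₁ - + s     ≡⟨ cong₂ (λ a b → a - b - + s) sum≡ l₁≡l₁' ⟩
      (l₁' + l₂' + + s) - l₁' - + s  ≡⟨ second l₁' l₂' (+ s) ⟩
      l₂'                      ∎

module Representations {s c k : ℕ} (reg : SRegular s c k) where

  open import Data.Nat as N using (ℕ; NonZero)
  import Data.Nat.DivMod as NDM
  import Data.Nat.Divisibility as ND
  open import Data.Integer using (ℤ; +_; ∣_∣; _+_; _-_; _*_; -_)
  import Data.Integer.Properties as ZP
  import Data.Integer.Divisibility.Signed as S
  open import Data.Integer.Tactic.RingSolver using (solve-∀)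
  open import Data.Product using (_×_; _,_; proj₁; proj₂)
  open import Relation.Binary.PropositionalEquality
  open Congruences
  open DiagonalCoordinates

  u v : ℤ
  u = proj₁ reg
  v = proj₁ (proj₂ reg)

  record Representation (x y : ℤ) : Set where
    field
      l₁ l₂  : ℤ
      short  : ∣ l₁ ∣ N.+ ∣ l₂ ∣ N.≤ s
      first  : (l₁ + l₂) ≡[ c ] x
      second : (l₁ * u + l₂ * v) ≡[ c N.* k ] y

  represent : ∀ x y → Representation x y
  represent x y = let (l₁ , l₂ , short , first , second) = proj₂ (proj₂ reg) x y in
    record { l₁ = l₁ ; l₂ = l₂ ; short = short ; first = first ; second = second }

  -- The representation w of (0 , 1) gives w₁ (u - v) ≡ 1, so u - v is a unit modulo c and
  -- (l₁ - r₁)(u - v) ≡ 0 forces l₁ ≡ r₁.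
  first-coefficient≡ : ∀ {l₁ l₂ r₁ r₂} → (l₁ + l₂) ≡[ c ] (r₁ + r₂) →
    (l₁ * u + l₂ * v) ≡[ c ] (r₁ * u + r₂ * v) → l₁ ≡[ c ] r₁
  first-coefficient≡ {l₁} {l₂} {r₁} {r₂} sum≡ combination≡ = ∣⇒≡[] l₁ r₁
    (subst (+ c S.∣_) (sym (identity l₁ l₂ r₁ r₂ w₁ w₂ u v))
      (S.∣m∣n⇒∣m+n (S.∣m∣n⇒∣m-n (S.∣n⇒∣m*n w₁ (S.∣m∣n⇒∣m-n combination (S.∣m⇒∣m*n v sum)))
                                (S.∣n⇒∣m*n (l₁ - r₁) w-combination))
                   (S.∣m⇒∣m*n v (S.∣n⇒∣m*n (l₁ - r₁) w-sum))))
    where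
    open Representation (represent (+ 0) (+ 1)) renaming (l₁ to w₁; l₂ to w₂; first to w-first; second to w-second)
    sum : + c S.∣ (l₁ + l₂) - (r₁ + r₂)
    sum = ≡[]⇒∣ (l₁ + l₂) (r₁ + r₂) sum≡
    combination : + c S.∣ (l₁ * u + l₂ * v) - (r₁ * u + r₂ * v)
    combination = ≡[]⇒∣ (l₁ * u + l₂ * v) (r₁ * u + r₂ * v) combination≡
    w-sum : + c S.∣ (w₁ + w₂) - + 0
    w-sum = ≡[]⇒∣ (w₁ + w₂) (+ 0) w-first
    w-combination : + c S.∣ (w₁ * u + w₂ * v) - + 1
    w-combination = ≡[]⇒∣ (w₁ * u + w₂ * v) (+ 1) (≡[*]⇒≡[] {a = w₁ * u + w₂ * v} {+ 1} k w-second)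
    identity : ∀ l₁ l₂ r₁ r₂ w₁ w₂ u v → l₁ - r₁ ≡
      w₁ * (((l₁ * u + l₂ * v) - (r₁ * u + r₂ * v)) - ((l₁ + l₂) - (r₁ + r₂)) * v)
        - (l₁ - r₁) * ((w₁ * u + w₂ * v) - + 1) + ((l₁ - r₁) * ((w₁ + w₂) - + 0)) * v
    identity = solve-∀

  module Coset (x : ℤ) (y : ℕ → ℤ) where

    open Representation

    rep : ∀ j → Representation x (y j)
    rep j = represent x (y j)

    diag : ∀ j → Diagonal s (l₁ (rep j)) (l₂ (rep j))
    diag j = diagonal (short (rep j))

    P Q : ℕ → ℕ
    P j = Diagonal.P (diag j)
    Q j = Diagonal.Q (diag j)

    +P≡x+s : ∀ j → (+ P j) ≡[ c ] (x + + s)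
    +P≡x+s j = subst (λ t → c ND.∣ ∣ t ∣) (cong (_- (x + + s)) (sym (Diagonal.+P≡ (diag j))))
      (subst (λ t → c ND.∣ ∣ t ∣) (shifted (l₁ r) (l₂ r) x (+ s)) (first r))
      where
      r : Representation x (y j)
      r = rep j
      shifted : ∀ a b x s → (a + b) - x ≡ (a + b + s) - (x + s)
      shifted = solve-∀

    coordinates≡⇒targets≡ : ∀ {j j'} → P j ≡ P j' → Q j ≡ Q j' → y j ≡[ c N.* k ] y j'
    coordinates≡⇒targets≡ {j} {j'} P≡P' Q≡Q' with diagonal-injective (diag j) (diag j') P≡P' Q≡Q'
    ... | l₁≡ , l₂≡ = ≡[]-trans {a = y j} (≡[]-sym {a = l₁ r * u + l₂ r * v} (second r))
                        (subst (λ t → t ≡[ c N.* k ] y j') (cong₂ (λ a b → a * u + b * v) (sym l₁≡) (sym l₂≡))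
                          (second r'))
      where
      r : Representation x (y j)
      r = rep j
      r' : Representation x (y j')
      r' = rep j'

  module Row (j₀ : ℕ) .{{_ : NonZero c}} where

    open Coset (+ j₀ - + s) +_ public

    row : ℕ → ℕ
    row j = P j N./ c

    P≡j₀+row*c : j₀ N.< c → ∀ j → P j ≡ j₀ N.+ row j N.* c
    P≡j₀+row*c j₀<c j = trans (NDM.m≡m%n+[m/n]*n (P j) c) (cong (N._+ row j N.* c) P%c≡j₀)
      where
      j₀-s+s : ∀ j₀ s → j₀ - s + s ≡ j₀
      j₀-s+s = solve-∀
      P%c≡j₀ : P j N.% c ≡ j₀
      P%c≡j₀ = trans (≡[]⇒%≡ (subst (λ t → (+ P j) ≡[ c ] t) (j₀-s+s (+ j₀) (+ s)) (+P≡x+s j)))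
                     (NDM.m<n⇒m%n≡m j₀<c)

    row-injective : j₀ N.< c → ∀ {j j'} → j N.< c N.* k → j' N.< c N.* k →
      row j ≡ row j' → Q j ≡ Q j' → j ≡ j'
    row-injective j₀<c {j} {j'} j< j'< row≡ Q≡ = ≡[]-<⇒≡ j< j'< (coordinates≡⇒targets≡ P≡ Q≡)
      where
      P≡ : P j ≡ P j'
      P≡ = trans (P≡j₀+row*c j₀<c j) (trans (cong (λ i → j₀ N.+ i N.* c) row≡) (sym (P≡j₀+row*c j₀<c j')))

  -- Every representation of a target in the coset (r₁ + r₂ , r₁ u + r₂ v + c ℤ) has l ≡ r (mod c);
  -- r = (1 , -(1 + s)) is chosen so that P ≡ 0 and Q ≡ 2s + 2 (mod c).
  module Sublattice where

    r₁ r₂ : ℤ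
    r₁ = + 1
    r₂ = - (+ 1 + + s)

    target : ℕ → ℤ
    target j = r₁ * u + r₂ * v + + c * + j

    open Coset (r₁ + r₂) target public
    open Representation

    module _ (j : ℕ) where

      private
        a b : ℤ
        a = l₁ (rep j)
        b = l₂ (rep j)

      l₁≡r₁ : a ≡[ c ] r₁
      l₁≡r₁ = first-coefficient≡ {a} {b} {r₁} {r₂} (first (rep j))
        (≡[]-trans {a = a * u + b * v} {target j} (≡[*]⇒≡[] {a = a * u + b * v} {target j} k (second (rep j)))
          (∣⇒≡[] (y₀ + + c * + j) y₀ (S.divides (+ j) (drop-multiple y₀ (+ c) (+ j)))))
        where
        y₀ : ℤ
        y₀ = r₁ * u + r₂ * v
        drop-multiple : ∀ y₀ c j → y₀ + c * j - y₀ ≡ j * c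
        drop-multiple = solve-∀

      l₂≡r₂ : b ≡[ c ] r₂
      l₂≡r₂ = ∣⇒≡[] b r₂ (subst (+ c S.∣_) (difference a b r₁ r₂)
        (S.∣m∣n⇒∣m-n (≡[]⇒∣ (a + b) (r₁ + r₂) (first (rep j))) (≡[]⇒∣ a r₁ l₁≡r₁)))
        where
        difference : ∀ a b x y → ((a + b) - (x + y)) - (a - x) ≡ b - y
        difference = solve-∀

      P≡0[c] : (+ P j) ≡[ c ] (+ 0)
      P≡0[c] = ∣⇒≡[] (+ P j) (+ 0)
        (subst (+ c S.∣_) (trans (sym (split a b (+ s))) (cong (_- + 0) (sym (Diagonal.+P≡ (diag j)))))
        (S.∣m∣n⇒∣m+n (≡[]⇒∣ a r₁ l₁≡r₁) (≡[]⇒∣ b r₂ l₂≡r₂)))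
        where
        split : ∀ a b s → a + b + s - + 0 ≡ (a - + 1) + (b - - (+ 1 + s))
        split = solve-∀

      Q≡1[c] : c ND.∣ N.suc (s N.+ s) → (+ Q j) ≡[ c ] (+ 1)
      Q≡1[c] c∣2s+1 = ∣⇒≡[] (+ Q j) (+ 1)
        (subst (+ c S.∣_) (trans (sym (split a b (+ s))) (cong (_- + 1) (sym (Diagonal.+Q≡ (diag j)))))
          (S.∣m∣n⇒∣m+n (S.∣m∣n⇒∣m-n (≡[]⇒∣ a r₁ l₁≡r₁) (≡[]⇒∣ b r₂ l₂≡r₂))
                       (S.∣ᵤ⇒∣ {+ c} {+ 1 + + s + + s} c∣2s+1)))
        where
        split : ∀ a b s → a - b + s - + 1 ≡ ((a - + 1) - (b - - (+ 1 + s))) + (+ 1 + s + s)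
        split = solve-∀

    coordinates-injective : .{{_ : NonZero c}} → ∀ {j j'} → j N.< k → j' N.< k → P j ≡ P j' → Q j ≡ Q j' → j ≡ j'
    coordinates-injective {j} {j'} j<k j'<k P≡ Q≡ = ≡[]-<⇒≡ j<k j'<k
      (ND.*-cancelˡ-∣ c (subst (c N.* k ND.∣_)
        (trans (cong ∣_∣ (difference (r₁ * u + r₂ * v) (+ c) (+ j) (+ j'))) (ZP.abs-* (+ c) (+ j - + j')))
        (coordinates≡⇒targets≡ P≡ Q≡)))
      where
      difference : ∀ a c j j' → (a + c * j) - (a + c * j') ≡ c * (j - j')
      difference = solve-∀

open import Data.Nat
open import Data.Nat.Properties
open import Data.Nat.DivMod
open import Data.Nat.Divisibility using (divides)
open import Data.Nat.Tactic.RingSolver using (solve-∀)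
open import Data.Product using (_×_; _,_; proj₁; proj₂)
open import Data.Sum using (_⊎_; inj₁; inj₂)
open import Function.Bundles using (_⇔_; mk⇔)
open import Relation.Binary.PropositionalEquality hiding (J)
open import Relation.Nullary using (¬_; Dec; yes; no; from-yes; from-no; contradiction)
open Arithmetic
open Quotients

module RowCount {s c k : ℕ} (reg : SRegular s c k) (j₀ : ℕ) .{{_ : NonZero c}} where

  open Representations.Row reg j₀
  open DiagonalCoordinates

  row<m : ∀ {ρ m} → j₀ < c → ρ ≤ j₀ → ρ + m * c ≡ suc (s + s) → ∀ j → row j < m
  row<m {ρ} {m} j₀<c ρ≤j₀ 2s+1≡ j = *-cancelʳ-< c (row j) m (+-cancelˡ-< j₀ _ _ (begin-strict
    j₀ + row j * c    ≡⟨ P≡j₀+row*c j₀<c j ⟨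
    P j               <⟨ s≤s (Diagonal.P≤2s (diag j)) ⟩
    suc (s + s)       ≡⟨ 2s+1≡ ⟨
    ρ + m * c         ≤⟨ +-monoˡ-≤ (m * c) ρ≤j₀ ⟩
    j₀ + m * c        ∎))
    where open ≤-Reasoning

  count : ∀ {ρ m} D r T → j₀ < c → ρ ≤ j₀ → ρ + m * c ≡ suc (s + s) →
    (∀ j → Q j < D) → (∀ j → (Q j + row j * D) % 2 ≡ r) → m * D ≤ r + T * 2 → c * k ≤ T
  count {ρ} {m} D r T j₀<c ρ≤j₀ 2s+1≡ Q<D z%2≡ mD≤ =
    residue-class-injection⇒≤ z z%2≡ z< z-injective
    where
    z : ℕ → ℕ
    z j = Q j + row j * D
    z< : ∀ j → z j < r + T * 2
    z< j = begin-strict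
      Q j + row j * D   <⟨ +-monoˡ-< (row j * D) (Q<D j) ⟩
      suc (row j) * D   ≤⟨ *-monoˡ-≤ D (row<m {m = m} j₀<c ρ≤j₀ 2s+1≡ j) ⟩
      m * D             ≤⟨ mD≤ ⟩
      r + T * 2         ∎
      where open ≤-Reasoning
    z-injective : ∀ {j j'} → j < c * k → j' < c * k → z j ≡ z j' → j ≡ j'
    z-injective {j} {j'} j< j'< z≡ = row-injective j₀<c j< j'< (proj₂ Q≡∧row≡) (proj₁ Q≡∧row≡)
      where
      Q≡∧row≡ : Q j ≡ Q j' × row j ≡ row j'
      Q≡∧row≡ = +-*-injective {D} {row j} {row j'} {Q j} {Q j'} (Q<D j) (Q<D j') z≡

  -- For even c and odd j₀, every P and hence every Q is odd, so Q < 2s.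
  even-count : ∀ {g ρ m} → c ≡ suc g * 2 → j₀ ≡ suc (g * 2) → ρ ≤ j₀ → ρ + m * c ≡ suc (s + s) →
    c * k ≤ m * s
  even-count {g} {ρ} {m} c≡ j₀≡ ρ≤j₀ 2s+1≡ =
    count {m = m} (s + s) 1 (m * s) j₀<c ρ≤j₀ 2s+1≡ Q<2s z%2≡ (≤-trans (≤-reflexive (twice m s)) (m≤n+m _ 1))
    where
    twice : ∀ m s → m * (s + s) ≡ 0 + (m * s) * 2
    twice = solve-∀
    j₀<c : j₀ < c
    j₀<c = subst₂ _<_ (sym j₀≡) (sym c≡) (n<1+n _)
    Q%2≡1 : ∀ j → Q j % 2 ≡ 1
    Q%2≡1 j = trans (sym (Diagonal.P≡Q[2] (diag j))) (≡+*⇒%≡ {b = 1} {g + row j * suc g} (begin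
      P j                                 ≡⟨ P≡j₀+row*c j₀<c j ⟩
      j₀ + row j * c                      ≡⟨ cong₂ (λ a b → a + row j * b) j₀≡ c≡ ⟩
      suc (g * 2) + row j * (suc g * 2)   ≡⟨ odd g (row j) ⟩
      1 + (g + row j * suc g) * 2         ∎))
      where
      open ≡-Reasoning
      odd : ∀ g i → suc (g * 2) + i * (suc g * 2) ≡ 1 + (g + i * suc g) * 2
      odd = solve-∀
    Q<2s : ∀ j → Q j < s + s
    Q<2s j = ≤∧≢⇒< (Diagonal.Q≤2s (diag j))
      λ Q≡2s → 0≢1+n (trans (sym (≡+*⇒%≡ {b = 0} {s} (trans Q≡2s (double s)))) (Q%2≡1 j))
      where
      double : ∀ s → s + s ≡ 0 + s * 2
      double = solve-∀
    z%2≡ : ∀ j → (Q j + row j * (s + s)) % 2 ≡ 1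
    z%2≡ j = trans (≡+*⇒%≡ {b = Q j} {row j * s} (cong (Q j +_) (trans (twice (row j) s) (+-identityˡ _)))) (Q%2≡1 j)

  odd-count : ∀ {e ρ m} T → c ≡ suc (e * 2) → j₀ < c → ρ ≤ j₀ → ρ + m * c ≡ suc (s + s) →
    m * suc (s + s) ≤ j₀ % 2 + T * 2 → c * k ≤ T
  odd-count {e} {m = m} T c≡ j₀<c ρ≤j₀ 2s+1≡ =
    count {m = m} (suc (s + s)) (j₀ % 2) T j₀<c ρ≤j₀ 2s+1≡ (λ j → s≤s (Diagonal.Q≤2s (diag j))) z%2≡
    where
    z%2≡ : ∀ j → (Q j + row j * suc (s + s)) % 2 ≡ j₀ % 2
    z%2≡ j = begin
      (Q j + row j * suc (s + s)) % 2  ≡⟨ %-congˡ-+ {Q j} {P j} (row j * suc (s + s)) 2 (sym (Diagonal.P≡Q[2] (diag j))) ⟩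
      (P j + row j * suc (s + s)) % 2  ≡⟨ ≡+*⇒%≡ {b = j₀} {row j * suc (e + s)} (begin
          P j + row j * suc (s + s)                   ≡⟨ cong (_+ row j * suc (s + s)) (P≡j₀+row*c j₀<c j) ⟩
          j₀ + row j * c + row j * suc (s + s)        ≡⟨ cong (λ c → j₀ + row j * c + row j * suc (s + s)) c≡ ⟩
          j₀ + row j * suc (e * 2) + row j * suc (s + s) ≡⟨ even-steps j₀ (row j) e s ⟩
          j₀ + (row j * suc (e + s)) * 2              ∎) ⟩
      j₀ % 2                           ∎
      where
      open ≡-Reasoning
      even-steps : ∀ j₀ i e s → j₀ + i * suc (e * 2) + i * suc (s + s) ≡ j₀ + (i * suc (e + s)) * 2
      even-steps = solve-∀

data OrderBound (s c k : ℕ) : Set where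
  strict    : c * (c * k) + 4 < 2 * s * s + 2 * s → OrderBound s c k
  extremal  : c ≡ 3 → s % 3 ≡ 1 → c * (c * k) + 4 ≤ 2 * s * s + 2 * s → OrderBound s c k

-- c²k ≤ X with 2X + d = (2s + 1)²; as 2(2s² + 2s - 4) + 9 = (2s + 1)², the extremal order
-- leaves d ≥ 9, and d ≥ 11 makes the bound strict.
record Defect (s c k d : ℕ) : Set where
  constructor defect
  field
    X       : ℕ
    c²k≤X   : c * (c * k) ≤ X
    2X+d≡   : X * 2 + d ≡ suc (s + s) * suc (s + s)

defect⇒≤ : ∀ {s c k d} t → Defect s c k d → t * 2 + 9 ≤ d → t + (c * (c * k) + 4) ≤ 2 * s * s + 2 * s
defect⇒≤ {s} {c} {k} {d} t (defect X c²k≤X 2X+d≡) t*2+9≤d = *-cancelʳ-≤ _ _ 2 (≤-pred (begin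
  suc ((t + (c * (c * k) + 4)) * 2)  ≤⟨ s≤s (*-monoˡ-≤ 2 (+-monoʳ-≤ t (+-monoˡ-≤ 4 c²k≤X))) ⟩
  suc ((t + (X + 4)) * 2)            ≡⟨ expand t X ⟩
  X * 2 + (t * 2 + 9)                ≤⟨ +-monoʳ-≤ (X * 2) t*2+9≤d ⟩
  X * 2 + d                          ≡⟨ 2X+d≡ ⟩
  suc (s + s) * suc (s + s)          ≡⟨ square s ⟩
  suc ((2 * s * s + 2 * s) * 2)      ∎))
  where
  open ≤-Reasoning
  expand : ∀ t X → suc ((t + (X + 4)) * 2) ≡ X * 2 + (t * 2 + 9)
  expand = solve-∀
  square : ∀ s → suc (s + s) * suc (s + s) ≡ suc ((2 * s * s + 2 * s) * 2)
  square = solve-∀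

even-defect : ∀ {s k} g → SRegular s (suc g * 2) k → Defect s (suc g * 2) k (suc (s * 4))
even-defect {s} {k} g reg = defect ((s + s) * s) c²k≤ (square s)
  where
  c ρ m : ℕ
  c = suc g * 2
  ρ = suc (s + s) % c
  m = suc (s + s) / c
  2s+1≡ : ρ + m * c ≡ suc (s + s)
  2s+1≡ = sym (m≡m%n+[m/n]*n (suc (s + s)) c)
  ρ≢0 : ρ ≢ 0
  ρ≢0 ρ≡0 = 0≢1+n (subst (λ ρ → ρ % 2 ≡ 1) ρ≡0
    (+*2≡2s+1⇒%2≡1 {ρ} {m * suc g} {s} (trans (cong (ρ +_) (*-assoc m (suc g) 2)) 2s+1≡)))
  mc≤2s : m * c ≤ s + s
  mc≤2s = ≤-pred (subst (suc (m * c) ≤_) 2s+1≡ (+-monoˡ-≤ (m * c) (n≢0⇒n>0 ρ≢0)))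
  c²k≤ : c * (c * k) ≤ (s + s) * s
  c²k≤ = begin
    c * (c * k)   ≤⟨ *-monoʳ-≤ c (RowCount.even-count {s} {c} {k} reg (suc (g * 2)) {g} {ρ} {m} refl refl
                                   (≤-pred (m%n<n (suc (s + s)) c)) 2s+1≡) ⟩
    c * (m * s)   ≡⟨ reassociate c m s ⟩
    m * c * s     ≤⟨ *-monoˡ-≤ s mc≤2s ⟩
    (s + s) * s   ∎
    where
    open ≤-Reasoning
    reassociate : ∀ c m s → c * (m * s) ≡ m * c * s
    reassociate = solve-∀
  square : ∀ s → (s + s) * s * 2 + suc (s * 4) ≡ suc (s + s) * suc (s + s)
  square = solve-∀

module SublatticeCount {s k e μ : ℕ} (reg : SRegular s (suc (e * 2)) k)
  (m*c≡ : suc (μ * 2) * suc (e * 2) ≡ suc (s + s)) (1≤e : 1 ≤ e) where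

  open Representations.Sublattice {s} {suc (e * 2)} {k} reg
  open DiagonalCoordinates
  open Congruences using (≡[]⇒%≡)

  private
    c m : ℕ
    c = suc (e * 2)
    m = suc (μ * 2)

  I J : ℕ → ℕ
  I j = P j / c
  J j = Q j / c

  P≡ : ∀ j → P j ≡ I j * c
  P≡ j = trans (m≡m%n+[m/n]*n (P j) c) (cong (_+ I j * c) (≡[]⇒%≡ {a = P j} {0} (P≡0[c] j)))

  Q≡ : ∀ j → Q j ≡ 1 + J j * c
  Q≡ j = trans (m≡m%n+[m/n]*n (Q j) c)
    (cong (_+ J j * c) (trans (≡[]⇒%≡ {a = Q j} {1} (Q≡1[c] j (divides m (sym m*c≡))))
                              (m<n⇒m%n≡m (≤-trans (from-yes (2 ≤? 3)) (s≤s (*-monoˡ-≤ 2 1≤e))))))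

  multiple<m : ∀ {i} x → x + i * c ≤ s + s → i < m
  multiple<m {i} x x+ic≤2s = *-cancelʳ-< c i m (s≤s (≤-trans (m≤n+m (i * c) x)
    (≤-pred (subst (suc (x + i * c) ≤_) (sym m*c≡) (s≤s x+ic≤2s)))))

  I<m : ∀ j → I j < m
  I<m j = multiple<m 0 (subst (_≤ s + s) (P≡ j) (Diagonal.P≤2s (diag j)))

  J<m : ∀ j → J j < m
  J<m j = multiple<m 1 (subst (_≤ s + s) (Q≡ j) (Diagonal.Q≤2s (diag j)))

  z : ℕ → ℕ
  z j = J j + I j * m

  I≡1+J[2] : ∀ j → I j % 2 ≡ (1 + J j) % 2
  I≡1+J[2] j = begin
    I j % 2        ≡⟨ ≡+*⇒%≡ {P j} {I j} {I j * e} (trans (P≡ j) (odd-multiple 0 (I j) e)) ⟨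
    P j % 2        ≡⟨ Diagonal.P≡Q[2] (diag j) ⟩
    Q j % 2        ≡⟨ ≡+*⇒%≡ {Q j} {1 + J j} {J j * e} (trans (Q≡ j) (odd-multiple 1 (J j) e)) ⟩
    (1 + J j) % 2  ∎
    where
    open ≡-Reasoning
    odd-multiple : ∀ a i e → a + i * suc (e * 2) ≡ (a + i) + (i * e) * 2
    odd-multiple = solve-∀

  z%2≡1 : ∀ j → z j % 2 ≡ 1
  z%2≡1 j = begin
    z j % 2              ≡⟨ ≡+*⇒%≡ {z j} {I j + J j} {I j * μ} (rearrange (I j) (J j) μ) ⟩
    (I j + J j) % 2      ≡⟨ %-congˡ-+ {I j} {1 + J j} (J j) 2 (I≡1+J[2] j) ⟩
    (1 + J j + J j) % 2  ≡⟨ ≡+*⇒%≡ {1 + J j + J j} {1} {J j} (double (J j)) ⟩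
    1                    ∎
    where
    open ≡-Reasoning
    rearrange : ∀ i j μ → j + i * suc (μ * 2) ≡ (i + j) + (i * μ) * 2
    rearrange = solve-∀
    double : ∀ j → 1 + j + j ≡ 1 + j * 2
    double = solve-∀

  z< : ∀ j → z j < 1 + (μ * μ + μ) * 2 * 2
  z< j = begin-strict
    J j + I j * m          <⟨ +-monoˡ-< (I j * m) (J<m j) ⟩
    suc (I j) * m          ≤⟨ *-monoˡ-≤ m (I<m j) ⟩
    m * m                  ≡⟨ square μ ⟩
    1 + (μ * μ + μ) * 2 * 2    ∎
    where
    open ≤-Reasoning
    square : ∀ μ → suc (μ * 2) * suc (μ * 2) ≡ 1 + (μ * μ + μ) * 2 * 2
    square = solve-∀

  z-injective : ∀ {j j'} → j < k → j' < k → z j ≡ z j' → j ≡ j'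
  z-injective {j} {j'} j<k j'<k z≡ = coordinates-injective j<k j'<k
    (trans (P≡ j) (trans (cong (_* c) (proj₂ J≡∧I≡)) (sym (P≡ j'))))
    (trans (Q≡ j) (trans (cong (λ J → 1 + J * c) (proj₁ J≡∧I≡)) (sym (Q≡ j'))))
    where
    J≡∧I≡ : J j ≡ J j' × I j ≡ I j'
    J≡∧I≡ = +-*-injective {m} {I j} {I j'} {J j} {J j'} (J<m j) (J<m j') z≡

  k≤ : k ≤ (μ * μ + μ) * 2
  k≤ = residue-class-injection⇒≤ z z%2≡1 z< z-injective

even-quotient-defect : ∀ {s k} e μ ρ → SRegular s (suc (e * 2)) k → ρ < suc (e * 2) →
  ρ + μ * 2 * suc (e * 2) ≡ suc (s + s) → Defect s (suc (e * 2)) k (ρ * suc (s + s))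
even-quotient-defect {s} {k} e μ ρ reg ρ<c 2s+1≡ = defect (c * (μ * B)) (*-monoʳ-≤ c ck≤) identity
  where
  c B : ℕ
  c = suc (e * 2)
  B = suc (s + s)
  ck≤ : c * k ≤ μ * B
  ck≤ = RowCount.odd-count {s} {c} {k} reg (e * 2) {e} {ρ} {μ * 2} (μ * B) refl (n<1+n _) (≤-pred ρ<c) 2s+1≡
    (subst (λ r → μ * 2 * B ≤ r + μ * B * 2) (sym (m*n%n≡0 e 2)) (≤-reflexive (rearrange μ B)))
    where
    rearrange : ∀ μ B → μ * 2 * B ≡ 0 + μ * B * 2
    rearrange = solve-∀
  identity : c * (μ * B) * 2 + ρ * B ≡ B * B
  identity = trans (rearrange c μ B ρ) (cong (_* B) 2s+1≡)
    where
    rearrange : ∀ c μ B ρ → c * (μ * B) * 2 + ρ * B ≡ (ρ + μ * 2 * c) * B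
    rearrange = solve-∀

last-residue-bound : ∀ {s k} e μ → 1 ≤ e → 3 ≤ s → SRegular s (suc (e * 2)) k →
  e * 2 + suc (μ * 2) * suc (e * 2) ≡ suc (s + s) →
  suc (e * 2) * (suc (e * 2) * k) + 4 < 2 * s * s + 2 * s
last-residue-bound {s} {k} e μ 1≤e 3≤s reg 2s+1≡ =
  defect⇒≤ {s} {c} {k} 1 (defect (c * suc (s + μ * B)) (*-monoʳ-≤ c ck≤) identity) (m+n≤o⇒m≤o∸n 11 11+c≤2eB)
  where
  c B : ℕ
  c = suc (e * 2)
  B = suc (s + s)
  ck≤ : c * k ≤ suc (s + μ * B)
  ck≤ = RowCount.odd-count {s} {c} {k} reg (e * 2) {e} {e * 2} {suc (μ * 2)} (suc (s + μ * B)) refl (n<1+n _) ≤-refl 2s+1≡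
    (subst (λ r → suc (μ * 2) * B ≤ r + suc (s + μ * B) * 2) (sym (m*n%n≡0 e 2))
      (≤-trans (n≤1+n _) (≤-reflexive (rearrange μ s))))
    where
    rearrange : ∀ μ s → suc (suc (μ * 2) * suc (s + s)) ≡ 0 + suc (s + μ * suc (s + s)) * 2
    rearrange = solve-∀
  11+c≤2eB : 11 + c ≤ e * 2 * B
  11+c≤2eB = begin
    12 + e * 2          ≤⟨ +-monoˡ-≤ (e * 2) (*-mono-≤ (*-mono-≤ 1≤e 3≤s) (≤-refl {4})) ⟩
    e * s * 4 + e * 2   ≡⟨ rearrange e s ⟩
    e * 2 * B           ∎
    where
    open ≤-Reasoning
    rearrange : ∀ e s → e * s * 4 + e * 2 ≡ e * 2 * suc (s + s)
    rearrange = solve-∀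
  identity : c * suc (s + μ * B) * 2 + (e * 2 * B ∸ c) ≡ B * B
  identity = +-cancelʳ-≡ c _ _ (begin
    c * suc (s + μ * B) * 2 + (e * 2 * B ∸ c) + c     ≡⟨ +-assoc (c * suc (s + μ * B) * 2) _ c ⟩
    c * suc (s + μ * B) * 2 + (e * 2 * B ∸ c + c)     ≡⟨ cong (c * suc (s + μ * B) * 2 +_)
                                                           (m∸n+n≡m (≤-trans (m≤n+m c 11) 11+c≤2eB)) ⟩
    c * suc (s + μ * B) * 2 + e * 2 * B               ≡⟨ rearrange c s μ e ⟩
    (e * 2 + suc (μ * 2) * c) * B + c                 ≡⟨ cong (λ t → t * B + c) 2s+1≡ ⟩
    B * B + c                                         ∎)
    where
    open ≡-Reasoning
    rearrange : ∀ c s μ e → c * suc (s + μ * suc (s + s)) * 2 + e * 2 * suc (s + s)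
                          ≡ (e * 2 + suc (μ * 2) * c) * suc (s + s) + c
    rearrange = solve-∀

middle-residue-bound : ∀ {s k} e μ ρ → 3 ≤ s → SRegular s (suc (suc e * 2)) k → 2 ≤ ρ → ρ ≤ suc (e * 2) →
  ρ + suc (μ * 2) * suc (suc e * 2) ≡ suc (s + s) →
  suc (suc e * 2) * (suc (suc e * 2) * k) + 4 < 2 * s * s + 2 * s
middle-residue-bound {s} {k} e μ ρ 3≤s reg 2≤ρ ρ≤j₀ 2s+1≡ =
  defect⇒≤ {s} {c} {k} 1 (defect (c * (s + μ * B)) (*-monoʳ-≤ c ck≤) identity)
    (≤-trans (from-yes (11 ≤? 14)) (≤-trans (*-mono-≤ 2≤ρ (s≤s (+-mono-≤ 3≤s 3≤s))) (m≤n+m (ρ * B) c)))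
  where
  c B : ℕ
  c = suc (suc e * 2)
  B = suc (s + s)
  ck≤ : c * k ≤ s + μ * B
  ck≤ = RowCount.odd-count {s} {c} {k} reg (suc (e * 2)) {suc e} {ρ} {suc (μ * 2)} (s + μ * B) refl
          (s≤s (n≤1+n _)) ρ≤j₀ 2s+1≡
    (subst (λ r → suc (μ * 2) * B ≤ r + (s + μ * B) * 2) (sym (≡+*⇒%≡ {suc (e * 2)} {1} {e} refl))
      (≤-reflexive (rearrange μ s)))
    where
    rearrange : ∀ μ s → suc (μ * 2) * suc (s + s) ≡ 1 + (s + μ * suc (s + s)) * 2
    rearrange = solve-∀
  identity : c * (s + μ * B) * 2 + (c + ρ * B) ≡ B * B
  identity = trans (rearrange c s μ ρ) (cong (_* B) 2s+1≡)
    where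
    rearrange : ∀ c s μ ρ → c * (s + μ * suc (s + s)) * 2 + (c + ρ * suc (s + s)) ≡ (ρ + suc (μ * 2) * c) * suc (s + s)
    rearrange = solve-∀

-- The only regular case with too small a defect: s = 3, c = 3, where 3k ≤ 7 forces k ≤ 2.
small-case : ∀ {s k e μ} → 3 ≤ s → s ≤ 4 → 1 ≤ e → μ * suc (e * 2) ≡ s → suc (e * 2) * k ≤ μ * suc (s + s) →
  suc (e * 2) * (suc (e * 2) * k) + 4 < 2 * s * s + 2 * s
small-case {e = 0} _ _ () _ _
small-case {μ = 0} 3≤s _ _ refl _ = contradiction 3≤s λ ()
small-case {k = k} {e = 1} {μ = 1} _ _ _ refl 3k≤7 =
  ≤-<-trans (+-monoˡ-≤ 4 (*-monoʳ-≤ 3 (*-monoʳ-≤ 3 k≤2))) (from-yes (22 <? 24))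
  where
  k≤2 : k ≤ 2
  k≤2 = ≤-pred (*-cancelˡ-< 3 k 3 (≤-<-trans 3k≤7 (from-yes (7 <? 9))))
small-case {e = suc (suc e)} {μ = 1} _ s≤4 _ refl _ = contradiction s≤4 λ { (s≤s (s≤s (s≤s (s≤s ())))) }
small-case {e = suc e} {μ = suc (suc μ)} _ s≤4 _ refl _ =
  contradiction (≤-trans (*-mono-≤ (s≤s (s≤s (z≤n {μ}))) (s≤s (*-monoˡ-≤ 2 (s≤s (z≤n {e}))))) s≤4)
    (from-no (6 ≤? 4))

odd∧*<11⇒≡1 : ∀ {ρ B} → ρ % 2 ≡ 1 → 7 ≤ B → ρ * B < 11 → ρ ≡ 1
odd∧*<11⇒≡1 {0} () _ _
odd∧*<11⇒≡1 {1} _ _ _ = refl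
odd∧*<11⇒≡1 {suc (suc ρ)} _ 7≤B ρB<11 =
  contradiction (≤-trans (from-yes (11 ≤? 14)) (*-mono-≤ (s≤s (s≤s (z≤n {ρ}))) 7≤B)) (<⇒≱ ρB<11)

even-quotient-bound : ∀ {s k} e μ ρ → 1 ≤ e → 3 ≤ s → SRegular s (suc (e * 2)) k → ρ < suc (e * 2) →
  ρ + μ * 2 * suc (e * 2) ≡ suc (s + s) →
  suc (e * 2) * (suc (e * 2) * k) + 4 < 2 * s * s + 2 * s
even-quotient-bound {s} {k} e μ ρ 1≤e 3≤s reg ρ<c 2s+1≡ = by-defect (11 ≤? ρ * suc (s + s))
  where
  c : ℕ
  c = suc (e * 2)
  quotient-defect : Defect s c k (ρ * suc (s + s))
  quotient-defect = even-quotient-defect e μ ρ reg ρ<c 2s+1≡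
  ρ≡1 : ¬ 11 ≤ ρ * suc (s + s) → ρ ≡ 1
  ρ≡1 ρB≱11 = odd∧*<11⇒≡1 (+*2≡2s+1⇒%2≡1 {ρ} {μ * c} {s} (trans (cong (ρ +_) (rearrange μ c)) 2s+1≡))
    (s≤s (+-mono-≤ 3≤s 3≤s)) (≰⇒> ρB≱11)
    where
    rearrange : ∀ μ c → μ * c * 2 ≡ μ * 2 * c
    rearrange = solve-∀
  by-defect : Dec (11 ≤ ρ * suc (s + s)) → c * (c * k) + 4 < 2 * s * s + 2 * s
  by-defect (yes 11≤ρB) = defect⇒≤ 1 quotient-defect 11≤ρB
  by-defect (no ρB≱11) = small-case {s} {k} {e} {μ} 3≤s s≤4 1≤e μc≡s
    (*-cancelˡ-≤ {c * k} {μ * suc (s + s)} c (Defect.c²k≤X quotient-defect))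
    where
    s≤4 : s ≤ 4
    s≤4 = ≤-pred (*-cancelʳ-< 2 s 5
      (≤-pred (subst (_< 11) (trans (cong (_* suc (s + s)) (ρ≡1 ρB≱11)) (double s)) (≰⇒> ρB≱11))))
      where
      double : ∀ s → 1 * suc (s + s) ≡ suc (s * 2)
      double = solve-∀
    μc≡s : μ * c ≡ s
    μc≡s = *-cancelʳ-≡ (μ * c) s 2 (suc-injective (trans (rearrange μ c)
      (trans (subst (λ ρ → ρ + μ * 2 * c ≡ suc (s + s)) (ρ≡1 ρB≱11) 2s+1≡) (double s))))
      where
      rearrange : ∀ μ c → suc (μ * c * 2) ≡ 1 + μ * 2 * c
      rearrange = solve-∀
      double : ∀ s → suc (s + s) ≡ suc (s * 2)
      double = solve-∀

sublattice-defect : ∀ {s k} e μ → 1 ≤ e → SRegular s (suc (e * 2)) k → suc (μ * 2) * suc (e * 2) ≡ suc (s + s) →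
  Defect s (suc (e * 2)) k (suc (e * 2) * suc (e * 2))
sublattice-defect {s} {k} e μ 1≤e reg m*c≡ = defect (c * c * T) c²k≤ (trans (square c μ) (cong₂ _*_ m*c≡ m*c≡))
  where
  c T : ℕ
  c = suc (e * 2)
  T = (μ * μ + μ) * 2
  c²k≤ : c * (c * k) ≤ c * c * T
  c²k≤ = subst (_≤ c * c * T) (*-assoc c c k) (*-monoʳ-≤ (c * c) (SublatticeCount.k≤ {s} {k} {e} {μ} reg m*c≡ 1≤e))
  square : ∀ c μ → c * c * ((μ * μ + μ) * 2) * 2 + c * c ≡ suc (μ * 2) * c * (suc (μ * 2) * c)
  square = solve-∀

sublattice-bound : ∀ {s k} e μ → 1 ≤ e → SRegular s (suc (e * 2)) k → suc (μ * 2) * suc (e * 2) ≡ suc (s + s) →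
  OrderBound s (suc (e * 2)) k
sublattice-bound {s} {k} 1 μ 1≤e reg m*c≡ =
  extremal refl s%3≡1 (defect⇒≤ {s} {3} {k} 0 (sublattice-defect 1 μ 1≤e reg m*c≡) ≤-refl)
  where
  s≡ : s ≡ 1 + μ * 3
  s≡ = *-cancelʳ-≡ s (1 + μ * 3) 2 (suc-injective (trans (double s) (trans (sym m*c≡) (rearrange μ))))
    where
    double : ∀ s → suc (s * 2) ≡ suc (s + s)
    double = solve-∀
    rearrange : ∀ μ → suc (μ * 2) * 3 ≡ suc ((1 + μ * 3) * 2)
    rearrange = solve-∀
  s%3≡1 : s % 3 ≡ 1
  s%3≡1 = ≡+*⇒%≡ {s} {1} {μ} s≡
sublattice-bound {s} {k} (suc (suc e)) μ 1≤e reg m*c≡ =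
  strict (defect⇒≤ {s} {suc (suc (suc e) * 2)} {k} 1 (sublattice-defect (suc (suc e)) μ 1≤e reg m*c≡)
    (≤-trans (from-yes (11 ≤? 25)) (*-mono-≤ 5≤c 5≤c)))
  where
  5≤c : 5 ≤ suc (suc (suc e) * 2)
  5≤c = s≤s (*-monoˡ-≤ 2 (s≤s (s≤s (z≤n {e}))))

odd-quotient-bound : ∀ {s k} e μ ρ → 1 ≤ e → 3 ≤ s → SRegular s (suc (e * 2)) k → ρ < suc (e * 2) →
  ρ + suc (μ * 2) * suc (e * 2) ≡ suc (s + s) → OrderBound s (suc (e * 2)) k
odd-quotient-bound {s} {k} e μ 0 1≤e _ reg _ m*c≡ = sublattice-bound {s} {k} e μ 1≤e reg m*c≡
odd-quotient-bound {s} e μ 1 _ _ _ _ 2s+1≡ = contradiction (trans (sym (≡+*⇒%≡ {s + s} {0} {s} (double s)))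
  (≡+*⇒%≡ {s + s} {1} {μ + e + μ * e * 2} (trans (suc-injective (sym 2s+1≡)) (rearrange μ e)))) 0≢1+n
  where
  double : ∀ s → s + s ≡ 0 + s * 2
  double = solve-∀
  rearrange : ∀ μ e → suc (μ * 2) * suc (e * 2) ≡ 1 + (μ + e + μ * e * 2) * 2
  rearrange = solve-∀
odd-quotient-bound {s} {k} e μ (suc (suc ρ)) 1≤e 3≤s reg ρ<c 2s+1≡ with suc (suc ρ) ≟ e * 2
... | yes ρ≡2e = strict (last-residue-bound {s} {k} e μ 1≤e 3≤s reg
  (subst (λ ρ → ρ + suc (μ * 2) * suc (e * 2) ≡ suc (s + s)) ρ≡2e 2s+1≡))
odd-quotient-bound {s} {k} (suc e) μ (suc (suc ρ)) _ 3≤s reg ρ<c 2s+1≡ | no ρ≢2e =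
  strict (middle-residue-bound {s} {k} e μ (suc (suc ρ)) 3≤s reg (s≤s (s≤s z≤n))
    (≤-pred (≤∧≢⇒< (≤-pred ρ<c) ρ≢2e)) 2s+1≡)

-- With c = 2e + 1 and 2s + 1 = ρ + m c, P is confined to the class j₀ = c - 1 when m is even or
-- ρ = c - 1, to j₀ = c - 2 for the other ρ ≠ 0, and ρ = 0 is the sublattice case.
odd-bound : ∀ {s k} e ρ m → 1 ≤ e → 3 ≤ s → SRegular s (suc (e * 2)) k → ρ < suc (e * 2) →
  ρ + m * suc (e * 2) ≡ suc (s + s) → OrderBound s (suc (e * 2)) k
odd-bound {s} {k} e ρ m 1≤e 3≤s reg ρ<c 2s+1≡ with parity-split m
... | inj₁ (μ , refl) = strict (even-quotient-bound {s} {k} e μ ρ 1≤e 3≤s reg ρ<c 2s+1≡)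
... | inj₂ (μ , refl) = odd-quotient-bound {s} {k} e μ ρ 1≤e 3≤s reg ρ<c 2s+1≡

order-bound : ∀ {s c k} → 3 ≤ s → 2 ≤ c → SRegular s c k → OrderBound s c k
order-bound {s} {c} {k} 3≤s 2≤c reg with parity-split c
... | inj₁ (0 , refl) = contradiction 2≤c λ ()
... | inj₁ (suc g , refl) = strict (defect⇒≤ {s} {suc g * 2} {k} 1 (even-defect {s} {k} g reg)
  (s≤s (≤-trans (from-yes (10 ≤? 12)) (*-monoˡ-≤ 4 3≤s))))
... | inj₂ (0 , refl) = contradiction 2≤c λ { (s≤s ()) }
... | inj₂ (suc e , refl) =
  odd-bound {s} {k} (suc e) (suc (s + s) % c) (suc (s + s) / c) (s≤s z≤n) 3≤s reg
    (m%n<n (suc (s + s)) c) (sym (m≡m%n+[m/n]*n (suc (s + s)) c))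

OrderBound⇒≤ : ∀ {s c k} → OrderBound s c k → c * (c * k) ≤ 2 * s * s + 2 * s ∸ 4
OrderBound⇒≤ (strict c²k+4<V)         = m+n≤o⇒m≤o∸n _ (<⇒≤ c²k+4<V)
OrderBound⇒≤ (extremal _ _ c²k+4≤V)  = m+n≤o⇒m≤o∸n _ c²k+4≤V

OrderBound-extremal : ∀ {s c k} → OrderBound s c k → c * (c * k) ≡ 2 * s * s + 2 * s ∸ 4 → c ≡ 3 × s % 3 ≡ 1
OrderBound-extremal {s} {c} {k} (strict c²k+4<V) c²k≡ =
  contradiction (subst (_< 2 * s * s + 2 * s) (trans (cong (_+ 4) c²k≡) (m∸n+n≡m 4≤V)) c²k+4<V) (<-irrefl refl)
  where
  4≤V : 4 ≤ 2 * s * s + 2 * s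
  4≤V = ≤-trans (m≤n+m 4 (c * (c * k))) (<⇒≤ c²k+4<V)
OrderBound-extremal (extremal c≡3 s%3≡1 _) _ = c≡3 , s%3≡1

3∣extremal-order : ∀ s → s % 3 ≡ 1 → (2 * s * s + 2 * s ∸ 4) / 3 * 3 ≡ 2 * s * s + 2 * s ∸ 4
3∣extremal-order s s%3≡1 = begin
  (2 * s * s + 2 * s ∸ 4) / 3 * 3  ≡⟨ cong (λ n → n / 3 * 3) V∸4≡ ⟩
  W * 3 / 3 * 3                    ≡⟨ cong (_* 3) (m*n/n≡m W 3) ⟩
  W * 3                            ≡⟨ V∸4≡ ⟨
  2 * s * s + 2 * s ∸ 4            ∎
  where
  open ≡-Reasoning
  q W : ℕ
  q = s / 3
  W = q * q * 6 + q * 6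
  s≡ : s ≡ 1 + q * 3
  s≡ = trans (m≡m%n+[m/n]*n s 3) (cong (_+ q * 3) s%3≡1)
  V∸4≡ : 2 * s * s + 2 * s ∸ 4 ≡ W * 3
  V∸4≡ = trans (cong (λ s → 2 * s * s + 2 * s ∸ 4) s≡) (trans (cong (_∸ 4) (expand q)) (m+n∸n≡m (W * 3) 4))
    where
    expand : ∀ q → 2 * (1 + q * 3) * (1 + q * 3) + 2 * (1 + q * 3) ≡ (q * q * 6 + q * 6) * 3 + 4
    expand = solve-∀

mainTheorem10 : (s c k : ℕ) → 3 ≤ s → 2 ≤ c → 1 ≤ k → SRegular s c k →
    (c * (c * k) ≤ 2 * s * s + 2 * s ∸ 4) ×
    ((c * (c * k) ≡ 2 * s * s + 2 * s ∸ 4) ⇔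
      (Isomorphic c (c * k) 3 ((2 * s * s + 2 * s ∸ 4) / 3) × (s % 3 ≡ 1)))
mainTheorem10 s c k 3≤s 2≤c 1≤k reg = OrderBound⇒≤ bound , mk⇔ extremal⇒ ⇒extremal
  where
  bound : OrderBound s c k
  bound = order-bound 3≤s 2≤c reg
  extremal⇒ : c * (c * k) ≡ 2 * s * s + 2 * s ∸ 4 → Isomorphic c (c * k) 3 ((2 * s * s + 2 * s ∸ 4) / 3) × s % 3 ≡ 1
  extremal⇒ c²k≡ with OrderBound-extremal bound c²k≡
  ... | refl , s%3≡1 = subst (Isomorphic 3 (3 * k) 3) 3k≡ (Isomorphic-refl 3 (3 * k)) , s%3≡1
    where
    3k≡ : 3 * k ≡ (2 * s * s + 2 * s ∸ 4) / 3
    3k≡ = trans (sym (m*n/n≡m (3 * k) 3)) (cong (_/ 3) (trans (*-comm (3 * k) 3) c²k≡))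
  ⇒extremal : Isomorphic c (c * k) 3 ((2 * s * s + 2 * s ∸ 4) / 3) × s % 3 ≡ 1 → c * (c * k) ≡ 2 * s * s + 2 * s ∸ 4
  ⇒extremal (iso , s%3≡1) = ≤-antisym (OrderBound⇒≤ bound)
    (subst₂ _≤_ (3∣extremal-order s s%3≡1) (*-comm (c * k) c) (Isomorphic⇒order≤ iso))
    where
    instance
      c≢0 : NonZero c
      c≢0 = >-nonZero (≤-trans (s≤s z≤n) 2≤c)
      ck≢0 : NonZero (c * k)
      ck≢0 = >-nonZero (*-mono-≤ (≤-trans (s≤s z≤n) 2≤c) 1≤k)
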